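{- Let $m,n,r$ be positive integers with $\gcd(m,n)=1$ and let $d$ be a positive divisor of $n$. Then the numerators of the coefficients of the polynomials $X_{m,n,r}(1-dz)$ and $Y_{m,n,r}(1-dz)$ (in $\mathbb{Q}[z]$) are divisible by $d^r$.
   Context: ${}_2F_1(\alpha,\beta;\gamma;z) = 1 + \sum_{k\ge1} \frac{\alpha(\alpha+1)\cdots(\alpha+k-1)\,\beta(\beta+1)\cdots(\beta+k-1)}{\gamma(\gamma+1)\cdots(\gamma+k-1)\,k!} z^k$. For positive integers $m,n,r$ with $\gcd(m,n)=1$: $X_{m,n,r}(z) = z^r\,{}_2F_1(-r,-r-m/n;1-m/n;z^{ -1})$ and $Y_{m,n,r}(z) = {}_2F_1(-r,-r-m/n;1-m/n;z)$; both are polynomials in $\mathbb{Q}[z]$. Numerators are taken with the coefficients written in lowest terms. -}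

module Defs where

open import Data.Nat as ℕ using (ℕ; zero; suc)
open import Data.Integer as ℤ using (ℤ; +_; +[1+_]; -[1+_])
open import Data.Rational as ℚ using (ℚ; mkℚ; 0ℚ; 1ℚ; _/_; _+_; _*_; -_; 1/_)
open import Data.List using (List; []; _∷_; map; upTo; reverse)

-- Total reciprocal: inv 0 = 0 (convention), inv q = 1/q otherwise.
inv : ℚ → ℚ
inv (mkℚ (+ zero) _ _) = 0ℚ
inv p@(mkℚ +[1+ _ ] _ _) = 1/ p
inv p@(mkℚ -[1+ _ ] _ _) = 1/ p

fromℕ : ℕ → ℚ
fromℕ k = (+ k) / 1

frac : ℕ → ℕ → ℚ
frac m n = fromℕ m * inv (fromℕ n)

hα : ℕ → ℕ → ℕ → ℚ
hα m n r = - fromℕ r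

hβ : ℕ → ℕ → ℕ → ℚ
hβ m n r = - fromℕ r + - frac m n

hγ : ℕ → ℕ → ℕ → ℚ
hγ m n r = 1ℚ + - frac m n

-- k-th term of 2F1(α,β;γ;z):
--   (α)_k (β)_k / ((γ)_k k!)
hterm : ℕ → ℕ → ℕ → ℕ → ℚ
hterm m n r zero = 1ℚ
hterm m n r (suc k) =
  hterm m n r k * ((hα m n r + fromℕ k) * (hβ m n r + fromℕ k))
    * inv ((hγ m n r + fromℕ k) * fromℕ (suc k))

-- Polynomials over ℚ as coefficient lists, lowest degree first.
Poly : Set
Poly = List ℚ

_+ₚ_ : Poly → Poly → Poly
[] +ₚ q = q
(a ∷ p) +ₚ [] = a ∷ p
(a ∷ p) +ₚ (b ∷ q) = (a + b) ∷ (p +ₚ q)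

_·ₚ_ : ℚ → Poly → Poly
c ·ₚ p = map (c *_) p

_*ₚ_ : Poly → Poly → Poly
[] *ₚ q = []
(a ∷ p) *ₚ q = (a ·ₚ q) +ₚ (0ℚ ∷ (p *ₚ q))

_∘ₚ_ : Poly → Poly → Poly
[] ∘ₚ q = []
(a ∷ p) ∘ₚ q = (a ∷ []) +ₚ (q *ₚ (p ∘ₚ q))

-- Y_{m,n,r}(z) = 2F1(-r,-r-m/n;1-m/n;z) = Σ_{k=0}^{r} hterm k z^k
-- (the terms with k > r vanish since (-r)_k = 0)
Ypoly : ℕ → ℕ → ℕ → Poly
Ypoly m n r = map (hterm m n r) (upTo (suc r))

-- X_{m,n,r}(z) = z^r 2F1(...; z^{-1}) = Σ_{k=0}^{r} hterm k z^{r-k}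
Xpoly : ℕ → ℕ → ℕ → Poly
Xpoly m n r = reverse (Ypoly m n r)

oneMinus : ℕ → Poly
oneMinus d = 1ℚ ∷ (- fromℕ d) ∷ []

{-# OPTIONS --safe #-}
module Submission where

-- Let P(z) = Σ_{k≤r} c k z^k where c has the term ratio of 2F1(-r, -r-a; 1-a; z). By Taylor
-- expansion at 1, j! [z^j] P(1 - d z) = (-d)^j P⁽ʲ⁾(1), and T j = P⁽ʲ⁾(1) satisfies a first-order
-- recurrence in j, which integrates downwards from T r = r! c r to the closed form
--   [z^j] P(1 - d z) · (1-a)⁽ʳ⁾ = (-d)^j · (2r-j)! / (j! (r-j)!) · c 0 · (r+a)↓j      (j ≤ r),
-- the coefficients with j > r being 0. For Y take a = m/n and c k the hypergeometric terms; for X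
-- take a = -m/n and the reversed terms. Multiplying by n^r turns (1-a)⁽ʳ⁾ into Π_{k<r} (n - m + k n),
-- an integer prime to d (as d ∣ n and gcd(d, m) = 1), while n^j (r+a)↓j is an integer and n^(r-j)
-- contributes d^(r-j); so the coefficient times an integer prime to d is d^r times an integer.

open import Defs

open import Algebra.Bundles using (CommutativeRing)
import Algebra.Properties.CommutativeSemiring.Exp as Exp
open import Data.Empty using (⊥-elim)
open import Data.Integer as ℤ using (ℤ; +_; +[1+_]; -[1+_]; ∣_∣)
import Data.Integer.Properties as ℤP
open import Data.Integer.Divisibility using (_∣_)
import Data.Integer.Divisibility.Signed as ℤ∣
open import Data.List using ([]; _∷_; applyUpTo; applyDownFrom; reverse)
import Data.List.Properties as LP
open import Data.List.Relation.Unary.All using (All; []; _∷_; universal)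
open import Data.Nat as ℕ using (ℕ; zero; suc; _≤_; _^_; _!; z≤n; s≤s)
import Data.Nat.Properties as ℕP
open import Data.Nat.Combinatorics using (k![n∸k]!∣n!)
open import Data.Nat.Coprimality as Coprimality using (Coprime)
open import Data.Nat.Divisibility as ℕ∣ using (divides) renaming (_∣_ to _∣ₙ_)
open import Data.Nat.GCD using (gcd; gcd-greatest)
open import Data.Product using (∃-syntax; _×_; _,_; proj₁; proj₂)
open import Data.Rational as ℚ using (ℚ; mkℚ; 0ℚ; 1ℚ; _/_; _+_; _*_; -_; _-_; ↥_; ↧_)
import Data.Rational.Properties as ℚP
import Data.Rational.Unnormalised as ℚᵘ
import Data.Rational.Unnormalised.Properties as ℚᵘP
open import Data.Rational.Solver using (module +-*-Solver)
open import Data.Sum using (inj₁; inj₂; [_,_]′)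
open import Relation.Binary.PropositionalEquality
  using (_≡_; _≢_; refl; sym; trans; cong; cong₂; subst; module ≡-Reasoning)
open import Relation.Nullary using (¬_)
open import Algebra.Properties.Group ℚP.+-0-group using (x∙y⁻¹≈ε⇒x≈y; inverseʳ-unique)

open Exp (CommutativeRing.commutativeSemiring ℚP.+-*-commutativeRing)
  using () renaming (_^_ to _^ℚ_; ^-homo-* to ^ℚ-+; ^-distrib-* to ^ℚ-*)

fromℤ : ℤ → ℚ
fromℤ z = z / 1

toℚᵘ-fromℤ : ∀ z → ℚ.toℚᵘ (fromℤ z) ℚᵘ.≃ ℚᵘ.mkℚᵘ z 0
toℚᵘ-fromℤ z = ℚP.toℚᵘ-fromℚᵘ (ℚᵘ.mkℚᵘ z 0)

fromℤ-+ : ∀ x y → fromℤ (x ℤ.+ y) ≡ fromℤ x + fromℤ y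
fromℤ-+ x y = ℚP.toℚᵘ-injective (begin
  ℚ.toℚᵘ (fromℤ (x ℤ.+ y))                ≈⟨ toℚᵘ-fromℤ (x ℤ.+ y) ⟩
  ℚᵘ.mkℚᵘ (x ℤ.+ y) 0                     ≈⟨ ℚᵘ.*≡* (cong (ℤ._* + 1) (sym (cong₂ ℤ._+_ (ℤP.*-identityʳ x) (ℤP.*-identityʳ y)))) ⟩
  ℚᵘ.mkℚᵘ x 0 ℚᵘ.+ ℚᵘ.mkℚᵘ y 0            ≈⟨ ℚᵘP.+-cong (ℚᵘP.≃-sym (toℚᵘ-fromℤ x)) (ℚᵘP.≃-sym (toℚᵘ-fromℤ y)) ⟩
  ℚ.toℚᵘ (fromℤ x) ℚᵘ.+ ℚ.toℚᵘ (fromℤ y)  ≈⟨ ℚᵘP.≃-sym (ℚP.toℚᵘ-homo-+ (fromℤ x) (fromℤ y)) ⟩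
  ℚ.toℚᵘ (fromℤ x + fromℤ y)              ∎)
  where open ℚᵘP.≃-Reasoning

fromℤ-* : ∀ x y → fromℤ (x ℤ.* y) ≡ fromℤ x * fromℤ y
fromℤ-* x y = ℚP.toℚᵘ-injective (begin
  ℚ.toℚᵘ (fromℤ (x ℤ.* y))                ≈⟨ toℚᵘ-fromℤ (x ℤ.* y) ⟩
  ℚᵘ.mkℚᵘ (x ℤ.* y) 0                     ≈⟨ ℚᵘ.*≡* refl ⟩
  ℚᵘ.mkℚᵘ x 0 ℚᵘ.* ℚᵘ.mkℚᵘ y 0            ≈⟨ ℚᵘP.*-cong (ℚᵘP.≃-sym (toℚᵘ-fromℤ x)) (ℚᵘP.≃-sym (toℚᵘ-fromℤ y)) ⟩
  ℚ.toℚᵘ (fromℤ x) ℚᵘ.* ℚ.toℚᵘ (fromℤ y)  ≈⟨ ℚᵘP.≃-sym (ℚP.toℚᵘ-homo-* (fromℤ x) (fromℤ y)) ⟩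
  ℚ.toℚᵘ (fromℤ x * fromℤ y)              ∎)
  where open ℚᵘP.≃-Reasoning

fromℤ-neg : ∀ x → fromℤ (ℤ.- x) ≡ - fromℤ x
fromℤ-neg x = ℚP.toℚᵘ-injective (begin
  ℚ.toℚᵘ (fromℤ (ℤ.- x))   ≈⟨ toℚᵘ-fromℤ (ℤ.- x) ⟩
  ℚᵘ.mkℚᵘ (ℤ.- x) 0        ≈⟨ ℚᵘP.-‿cong (ℚᵘP.≃-sym (toℚᵘ-fromℤ x)) ⟩
  ℚᵘ.- ℚ.toℚᵘ (fromℤ x)    ≈⟨ ℚᵘP.≃-sym (ℚP.toℚᵘ-homo‿- (fromℤ x)) ⟩
  ℚ.toℚᵘ (- fromℤ x)       ∎)
  where open ℚᵘP.≃-Reasoning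

fromℤ-injective : ∀ x y → fromℤ x ≡ fromℤ y → x ≡ y
fromℤ-injective x y eq with ℚᵘP.≃-trans (ℚᵘP.≃-sym (toℚᵘ-fromℤ x)) (ℚᵘP.≃-trans (ℚP.toℚᵘ-cong eq) (toℚᵘ-fromℤ y))
... | ℚᵘ.*≡* x*1≡y*1 = trans (sym (ℤP.*-identityʳ x)) (trans x*1≡y*1 (ℤP.*-identityʳ y))

fromℕ-+ : ∀ a b → fromℕ (a ℕ.+ b) ≡ fromℕ a + fromℕ b
fromℕ-+ a b = trans (cong fromℤ (ℤP.pos-+ a b)) (fromℤ-+ (+ a) (+ b))

fromℕ-* : ∀ a b → fromℕ (a ℕ.* b) ≡ fromℕ a * fromℕ b
fromℕ-* a b = trans (cong fromℤ (ℤP.pos-* a b)) (fromℤ-* (+ a) (+ b))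

fromℕ-suc : ∀ k → fromℕ (suc k) ≡ fromℕ k + 1ℚ
fromℕ-suc k = trans (cong fromℕ (ℕP.+-comm 1 k)) (fromℕ-+ k 1)

fromℕ-^ : ∀ a k → fromℕ a ^ℚ k ≡ fromℕ (a ^ k)
fromℕ-^ a zero = refl
fromℕ-^ a (suc k) = trans (cong (fromℕ a *_) (fromℕ-^ a k)) (sym (fromℕ-* a (a ^ k)))

fromℕ-≢0 : ∀ k → k ≢ 0 → fromℕ k ≢ 0ℚ
fromℕ-≢0 k k≢0 eq = k≢0 (ℤP.+-injective (fromℤ-injective (+ k) (+ 0) eq))

fromℕ-suc≢0 : ∀ k → fromℕ (suc k) ≢ 0ℚ
fromℕ-suc≢0 k = fromℕ-≢0 (suc k) (λ ())

fromℕ-!≢0 : ∀ k → fromℕ (k !) ≢ 0ℚ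
fromℕ-!≢0 k = fromℕ-≢0 (k !) (ℕ.≢-nonZero⁻¹ (k !) {{k ℕP.!≢0}})

*-inv : ∀ p → p ≢ 0ℚ → p * inv p ≡ 1ℚ
*-inv (mkℚ (+ zero) d c) p≢0 = ⊥-elim (p≢0 (ℚP.↥p≡0⇒p≡0 (mkℚ (+ zero) d c) refl))
*-inv p@(mkℚ +[1+ _ ] _ _) _ = ℚP.*-inverseʳ p
*-inv p@(mkℚ -[1+ _ ] _ _) _ = ℚP.*-inverseʳ p

inv-*-cancelˡ : ∀ p q → p ≢ 0ℚ → inv p * (p * q) ≡ q
inv-*-cancelˡ p q p≢0 = begin
  inv p * (p * q)   ≡⟨ sym (ℚP.*-assoc (inv p) p q) ⟩
  inv p * p * q     ≡⟨ cong (_* q) (trans (ℚP.*-comm (inv p) p) (*-inv p p≢0)) ⟩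
  1ℚ * q            ≡⟨ ℚP.*-identityˡ q ⟩
  q                 ∎
  where open ≡-Reasoning

*-cancelˡ-≢0 : ∀ p {q r} → p ≢ 0ℚ → p * q ≡ p * r → q ≡ r
*-cancelˡ-≢0 p {q} {r} p≢0 eq = begin
  q                 ≡⟨ sym (inv-*-cancelˡ p q p≢0) ⟩
  inv p * (p * q)   ≡⟨ cong (inv p *_) eq ⟩
  inv p * (p * r)   ≡⟨ inv-*-cancelˡ p r p≢0 ⟩
  r                 ∎
  where open ≡-Reasoning

*-≢0 : ∀ {p q} → p ≢ 0ℚ → q ≢ 0ℚ → p * q ≢ 0ℚ
*-≢0 {p} {q} p≢0 q≢0 pq≡0 = q≢0 (*-cancelˡ-≢0 p p≢0 (trans pq≡0 (sym (ℚP.*-zeroʳ p))))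

coeff : Poly → ℕ → ℚ
coeff []      j       = 0ℚ
coeff (a ∷ p) zero    = a
coeff (a ∷ p) (suc j) = coeff p j

coeff-+ₚ : ∀ p q j → coeff (p +ₚ q) j ≡ coeff p j + coeff q j
coeff-+ₚ []      q       j       = sym (ℚP.+-identityˡ (coeff q j))
coeff-+ₚ (a ∷ p) []      j       = sym (ℚP.+-identityʳ (coeff (a ∷ p) j))
coeff-+ₚ (a ∷ p) (b ∷ q) zero    = refl
coeff-+ₚ (a ∷ p) (b ∷ q) (suc j) = coeff-+ₚ p q j

coeff-·ₚ : ∀ c p j → coeff (c ·ₚ p) j ≡ c * coeff p j
coeff-·ₚ c []      j       = sym (ℚP.*-zeroʳ c)
coeff-·ₚ c (a ∷ p) zero    = refl
coeff-·ₚ c (a ∷ p) (suc j) = coeff-·ₚ c p j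

-- coeff (0ℚ ∷ s) j is coeff s (j - 1), read as 0 at j = 0.
coeff-oneMinus-*ₚ : ∀ d s j → coeff (oneMinus d *ₚ s) j ≡ coeff s j - fromℕ d * coeff (0ℚ ∷ s) j
coeff-oneMinus-*ₚ d s j = begin
  coeff ((1ℚ ·ₚ s) +ₚ (0ℚ ∷ (((- D) ·ₚ s) +ₚ (0ℚ ∷ [])))) j
    ≡⟨ coeff-+ₚ (1ℚ ·ₚ s) _ j ⟩
  coeff (1ℚ ·ₚ s) j + coeff (0ℚ ∷ (((- D) ·ₚ s) +ₚ (0ℚ ∷ []))) j
    ≡⟨ cong₂ _+_ (coeff-·ₚ 1ℚ s j) (shifted j) ⟩
  1ℚ * coeff s j + (- D) * coeff (0ℚ ∷ s) j
    ≡⟨ solve 3 (λ x y D → con 1ℚ :* x :+ (:- D) :* y := x :- D :* y) refl (coeff s j) (coeff (0ℚ ∷ s) j) D ⟩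
  coeff s j - D * coeff (0ℚ ∷ s) j ∎
  where
  open ≡-Reasoning
  open +-*-Solver
  D = fromℕ d
  coeff-[0] : ∀ j → coeff (0ℚ ∷ []) j ≡ 0ℚ
  coeff-[0] zero    = refl
  coeff-[0] (suc j) = refl
  shifted : ∀ j → coeff (0ℚ ∷ (((- D) ·ₚ s) +ₚ (0ℚ ∷ []))) j ≡ (- D) * coeff (0ℚ ∷ s) j
  shifted zero    = sym (ℚP.*-zeroʳ (- D))
  shifted (suc j) = begin
    coeff (((- D) ·ₚ s) +ₚ (0ℚ ∷ [])) j      ≡⟨ coeff-+ₚ ((- D) ·ₚ s) _ j ⟩
    coeff ((- D) ·ₚ s) j + coeff (0ℚ ∷ []) j ≡⟨ cong₂ _+_ (coeff-·ₚ (- D) s j) (coeff-[0] j) ⟩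
    (- D) * coeff s j + 0ℚ                  ≡⟨ ℚP.+-identityʳ _ ⟩
    (- D) * coeff s j                       ∎

weightedSum : Poly → (ℕ → ℚ) → ℚ
weightedSum []      g = 0ℚ
weightedSum (a ∷ p) g = a * g 0 + weightedSum p (λ k → g (suc k))

weightedSum-cong : ∀ p {g h} → (∀ k → g k ≡ h k) → weightedSum p g ≡ weightedSum p h
weightedSum-cong []      g≗h = refl
weightedSum-cong (a ∷ p) g≗h = cong₂ _+_ (cong (a *_) (g≗h 0)) (weightedSum-cong p (λ k → g≗h (suc k)))

weightedSum-linear : ∀ p g h c → weightedSum p (λ k → g k + c * h k) ≡ weightedSum p g + c * weightedSum p h
weightedSum-linear []      g h c = solve 1 (λ c → con 0ℚ := con 0ℚ :+ c :* con 0ℚ) refl c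
  where open +-*-Solver
weightedSum-linear (a ∷ p) g h c = begin
  a * (g 0 + c * h 0) + weightedSum p (λ k → g (suc k) + c * h (suc k))
    ≡⟨ cong (λ t → a * (g 0 + c * h 0) + t) (weightedSum-linear p _ _ c) ⟩
  a * (g 0 + c * h 0) + (G + c * H)
    ≡⟨ solve 6 (λ a g h c G H → a :* (g :+ c :* h) :+ (G :+ c :* H) := (a :* g :+ G) :+ c :* (a :* h :+ H)) refl a (g 0) (h 0) c G H ⟩
  (a * g 0 + G) + c * (a * h 0 + H) ∎
  where
  open ≡-Reasoning
  open +-*-Solver
  G = weightedSum p (λ k → g (suc k))
  H = weightedSum p (λ k → h (suc k))

-- Falling and rising factorials

infixl 8 _↓_ _↑_

_↓_ : ℚ → ℕ → ℚ
x ↓ zero  = 1ℚ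
x ↓ suc j = x ↓ j * (x - fromℕ j)

_↑_ : ℚ → ℕ → ℚ
x ↑ zero  = 1ℚ
x ↑ suc j = x ↑ j * (x + fromℕ j)

↓-suc : ∀ x j → x ↓ suc j ≡ x * (x - 1ℚ) ↓ j
↓-suc x zero    = solve 1 (λ x → con 1ℚ :* (x :- con 0ℚ) := x :* con 1ℚ) refl x
  where open +-*-Solver
↓-suc x (suc j) = begin
  x ↓ suc j * (x - fromℕ (suc j))           ≡⟨ cong₂ _*_ (↓-suc x j) (cong (λ y → x - y) (fromℕ-suc j)) ⟩
  x * (x - 1ℚ) ↓ j * (x - (fromℕ j + 1ℚ))  ≡⟨ solve 3 (λ x f J → x :* f :* (x :- (J :+ con 1ℚ)) := x :* (f :* ((x :- con 1ℚ) :- J))) refl x ((x - 1ℚ) ↓ j) (fromℕ j) ⟩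
  x * ((x - 1ℚ) ↓ j * ((x - 1ℚ) - fromℕ j)) ∎
  where
  open ≡-Reasoning
  open +-*-Solver

fromℕ-suc-1 : ∀ k → fromℕ (suc k) - 1ℚ ≡ fromℕ k
fromℕ-suc-1 k = trans (cong (_- 1ℚ) (fromℕ-suc k)) (solve 1 (λ x → x :+ con 1ℚ :- con 1ℚ := x) refl (fromℕ k))
  where open +-*-Solver

fromℕ-suc↓suc : ∀ k j → fromℕ (suc k) ↓ suc j ≡ fromℕ (suc k) * fromℕ k ↓ j
fromℕ-suc↓suc k j = trans (↓-suc (fromℕ (suc k)) j) (cong (λ x → fromℕ (suc k) * x ↓ j) (fromℕ-suc-1 k))

0↓suc : ∀ j → 0ℚ ↓ suc j ≡ 0ℚ
0↓suc j = trans (↓-suc 0ℚ j) (ℚP.*-zeroˡ ((0ℚ - 1ℚ) ↓ j))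

↓-pascal : ∀ x j → (x + 1ℚ) ↓ suc j ≡ x ↓ suc j + fromℕ (suc j) * x ↓ j
↓-pascal x j = begin
  (x + 1ℚ) ↓ suc j                      ≡⟨ ↓-suc (x + 1ℚ) j ⟩
  (x + 1ℚ) * (x + 1ℚ - 1ℚ) ↓ j           ≡⟨ cong (λ y → (x + 1ℚ) * y ↓ j) (solve 1 (λ x → x :+ con 1ℚ :- con 1ℚ := x) refl x) ⟩
  (x + 1ℚ) * x ↓ j                       ≡⟨ solve 3 (λ x f J → (x :+ con 1ℚ) :* f := f :* (x :- J) :+ (J :+ con 1ℚ) :* f) refl x (x ↓ j) (fromℕ j) ⟩
  x ↓ suc j + (fromℕ j + 1ℚ) * x ↓ j     ≡⟨ cong (λ y → x ↓ suc j + y * x ↓ j) (sym (fromℕ-suc j)) ⟩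
  x ↓ suc j + fromℕ (suc j) * x ↓ j      ∎
  where
  open ≡-Reasoning
  open +-*-Solver

fromℕ↓-vanishes : ∀ {k j} → k ℕ.< j → fromℕ k ↓ j ≡ 0ℚ
fromℕ↓-vanishes {k} {suc j} k<1+j with ℕP.m≤n⇒m<n∨m≡n (ℕP.≤-pred k<1+j)
... | inj₁ k<j  = trans (cong (_* (fromℕ k - fromℕ j)) (fromℕ↓-vanishes k<j)) (ℚP.*-zeroˡ (fromℕ k - fromℕ j))
... | inj₂ refl = trans (cong (fromℕ k ↓ k *_) (ℚP.+-inverseʳ (fromℕ k))) (ℚP.*-zeroʳ (fromℕ k ↓ k))

fromℕ↓self : ∀ n → fromℕ n ↓ n ≡ fromℕ (n !)
fromℕ↓self zero    = refl
fromℕ↓self (suc n) = begin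
  fromℕ (suc n) ↓ suc n              ≡⟨ fromℕ-suc↓suc n n ⟩
  fromℕ (suc n) * fromℕ n ↓ n        ≡⟨ cong (fromℕ (suc n) *_) (fromℕ↓self n) ⟩
  fromℕ (suc n) * fromℕ (n !)        ≡⟨ sym (fromℕ-* (suc n) (n !)) ⟩
  fromℕ (suc n !)                    ∎
  where open ≡-Reasoning

↓≡↑ : ∀ b k → (b + fromℕ k) ↓ k ≡ (b + 1ℚ) ↑ k
↓≡↑ b zero    = refl
↓≡↑ b (suc k) = begin
  (b + fromℕ (suc k)) ↓ suc k                       ≡⟨ ↓-suc (b + fromℕ (suc k)) k ⟩
  (b + fromℕ (suc k)) * (b + fromℕ (suc k) - 1ℚ) ↓ k  ≡⟨ cong (λ y → (b + y) * (b + y - 1ℚ) ↓ k) (fromℕ-suc k) ⟩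
  (b + (K + 1ℚ)) * (b + (K + 1ℚ) - 1ℚ) ↓ k           ≡⟨ cong (λ y → (b + (K + 1ℚ)) * y ↓ k) (solve 2 (λ b K → b :+ (K :+ con 1ℚ) :- con 1ℚ := b :+ K) refl b K) ⟩
  (b + (K + 1ℚ)) * (b + K) ↓ k                       ≡⟨ cong ((b + (K + 1ℚ)) *_) (↓≡↑ b k) ⟩
  (b + (K + 1ℚ)) * (b + 1ℚ) ↑ k                      ≡⟨ solve 3 (λ b K R → (b :+ (K :+ con 1ℚ)) :* R := R :* (b :+ con 1ℚ :+ K)) refl b K ((b + 1ℚ) ↑ k) ⟩
  (b + 1ℚ) ↑ suc k                                   ∎
  where
  open ≡-Reasoning
  open +-*-Solver
  K = fromℕ k

weightedSum-↓-pascal : ∀ p j →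
  weightedSum p (λ k → fromℕ (suc k) ↓ suc j)
    ≡ weightedSum p (λ k → fromℕ k ↓ suc j) + fromℕ (suc j) * weightedSum p (λ k → fromℕ k ↓ j)
weightedSum-↓-pascal p j = begin
  weightedSum p (λ k → fromℕ (suc k) ↓ suc j)
    ≡⟨ weightedSum-cong p (λ k → trans (cong (_↓ suc j) (fromℕ-suc k)) (↓-pascal (fromℕ k) j)) ⟩
  weightedSum p (λ k → fromℕ k ↓ suc j + fromℕ (suc j) * fromℕ k ↓ j)
    ≡⟨ weightedSum-linear p (λ k → fromℕ k ↓ suc j) (λ k → fromℕ k ↓ j) (fromℕ (suc j)) ⟩
  weightedSum p (λ k → fromℕ k ↓ suc j) + fromℕ (suc j) * weightedSum p (λ k → fromℕ k ↓ j) ∎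
  where open ≡-Reasoning

-- Taylor expansion at 1; the weighted sum on the right is p⁽ʲ⁾(1).
coeff-∘ₚ-oneMinus : ∀ d p j →
  fromℕ (j !) * coeff (p ∘ₚ oneMinus d) j ≡ (- fromℕ d) ^ℚ j * weightedSum p (λ k → fromℕ k ↓ j)
coeff-∘ₚ-oneMinus d []      j       = trans (ℚP.*-zeroʳ (fromℕ (j !))) (sym (ℚP.*-zeroʳ ((- fromℕ d) ^ℚ j)))
coeff-∘ₚ-oneMinus d (a ∷ p) zero    = begin
  1ℚ * coeff ((a ∷ []) +ₚ (oneMinus d *ₚ s)) 0
    ≡⟨ cong (1ℚ *_) (trans (coeff-+ₚ (a ∷ []) (oneMinus d *ₚ s) 0) (cong (λ t → a + t) (coeff-oneMinus-*ₚ d s 0))) ⟩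
  1ℚ * (a + (coeff s 0 - D * 0ℚ))
    ≡⟨ solve 3 (λ a c D → con 1ℚ :* (a :+ (c :- D :* con 0ℚ)) := a :+ con 1ℚ :* c) refl a (coeff s 0) D ⟩
  a + 1ℚ * coeff s 0
    ≡⟨ cong (λ t → a + t) (coeff-∘ₚ-oneMinus d p 0) ⟩
  a + 1ℚ * weightedSum p (λ _ → 1ℚ)
    ≡⟨ solve 2 (λ a w → a :+ con 1ℚ :* w := con 1ℚ :* (a :* con 1ℚ :+ w)) refl a (weightedSum p (λ _ → 1ℚ)) ⟩
  1ℚ * (a * 1ℚ + weightedSum p (λ _ → 1ℚ)) ∎
  where
  open ≡-Reasoning
  open +-*-Solver
  s = p ∘ₚ oneMinus d
  D = fromℕ d
coeff-∘ₚ-oneMinus d (a ∷ p) (suc j) = begin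
  fromℕ (suc j !) * coeff ((a ∷ []) +ₚ (oneMinus d *ₚ s)) (suc j)
    ≡⟨ cong₂ _*_ (fromℕ-* (suc j) (j !)) (trans (coeff-+ₚ (a ∷ []) (oneMinus d *ₚ s) (suc j)) (cong (λ t → 0ℚ + t) (coeff-oneMinus-*ₚ d s (suc j)))) ⟩
  J * fromℕ (j !) * (0ℚ + (coeff s (suc j) - D * coeff s j))
    ≡⟨ solve 5 (λ J f c₁ c₀ D → J :* f :* (con 0ℚ :+ (c₁ :- D :* c₀)) := J :* f :* c₁ :+ (:- D) :* J :* (f :* c₀)) refl J (fromℕ (j !)) (coeff s (suc j)) (coeff s j) D ⟩
  J * fromℕ (j !) * coeff s (suc j) + (- D) * J * (fromℕ (j !) * coeff s j)
    ≡⟨ cong₂ _+_ (trans (cong (_* coeff s (suc j)) (sym (fromℕ-* (suc j) (j !)))) (coeff-∘ₚ-oneMinus d p (suc j)))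
                 (cong ((- D) * J *_) (coeff-∘ₚ-oneMinus d p j)) ⟩
  (- D) ^ℚ suc j * W (suc j) + (- D) * J * ((- D) ^ℚ j * W j)
    ≡⟨ solve 5 (λ D J P W₁ W₀ → (:- D) :* P :* W₁ :+ (:- D) :* J :* (P :* W₀) := (:- D) :* P :* (W₁ :+ J :* W₀)) refl D J ((- D) ^ℚ j) (W (suc j)) (W j) ⟩
  (- D) ^ℚ suc j * (W (suc j) + J * W j)
    ≡⟨ cong ((- D) ^ℚ suc j *_) (sym (weightedSum-↓-pascal p j)) ⟩
  (- D) ^ℚ suc j * W₊
    ≡⟨ cong ((- D) ^ℚ suc j *_) (sym a*0↓+W₊≡W₊) ⟩
  (- D) ^ℚ suc j * (a * fromℕ 0 ↓ suc j + W₊) ∎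
  where
  open ≡-Reasoning
  open +-*-Solver
  s = p ∘ₚ oneMinus d
  D = fromℕ d
  J = fromℕ (suc j)
  W : ℕ → ℚ
  W i = weightedSum p (λ k → fromℕ k ↓ i)
  W₊ = weightedSum p (λ k → fromℕ (suc k) ↓ suc j)
  a*0↓+W₊≡W₊ : a * fromℕ 0 ↓ suc j + W₊ ≡ W₊
  a*0↓+W₊≡W₊ = trans (cong (λ t → a * t + W₊) (0↓suc j)) (trans (cong (_+ W₊) (ℚP.*-zeroʳ a)) (ℚP.+-identityˡ W₊))

sumTo : ℕ → (ℕ → ℚ) → ℚ
sumTo zero    f = 0ℚ
sumTo (suc N) f = f 0 + sumTo N (λ k → f (suc k))

sumTo-cong : ∀ N {f g} → (∀ k → k ℕ.< N → f k ≡ g k) → sumTo N f ≡ sumTo N g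
sumTo-cong zero    f≗g = refl
sumTo-cong (suc N) f≗g = cong₂ _+_ (f≗g 0 (s≤s z≤n)) (sumTo-cong N (λ k k<N → f≗g (suc k) (s≤s k<N)))

sumTo-*ˡ : ∀ N c f → sumTo N (λ k → c * f k) ≡ c * sumTo N f
sumTo-*ˡ zero    c f = sym (ℚP.*-zeroʳ c)
sumTo-*ˡ (suc N) c f = trans (cong (λ t → c * f 0 + t) (sumTo-*ˡ N c (λ k → f (suc k))))
                             (sym (ℚP.*-distribˡ-+ c (f 0) _))

sumTo-linear : ∀ N f g c → sumTo N (λ k → f k + c * g k) ≡ sumTo N f + c * sumTo N g
sumTo-linear zero    f g c = solve 1 (λ c → con 0ℚ := con 0ℚ :+ c :* con 0ℚ) refl c
  where open +-*-Solver
sumTo-linear (suc N) f g c = begin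
  f 0 + c * g 0 + sumTo N (λ k → f (suc k) + c * g (suc k)) ≡⟨ cong (λ t → f 0 + c * g 0 + t) (sumTo-linear N _ _ c) ⟩
  f 0 + c * g 0 + (F + c * G)                                ≡⟨ solve 5 (λ f g c F G → f :+ c :* g :+ (F :+ c :* G) := f :+ F :+ c :* (g :+ G)) refl (f 0) (g 0) c F G ⟩
  f 0 + F + c * (g 0 + G)                                    ∎
  where
  open ≡-Reasoning
  open +-*-Solver
  F = sumTo N (λ k → f (suc k))
  G = sumTo N (λ k → g (suc k))

sumTo-vanishes : ∀ N {f} → (∀ k → k ℕ.< N → f k ≡ 0ℚ) → sumTo N f ≡ 0ℚ
sumTo-vanishes zero    f≗0 = refl
sumTo-vanishes (suc N) f≗0 =
  trans (cong₂ _+_ (f≗0 0 (s≤s z≤n)) (sumTo-vanishes N (λ k k<N → f≗0 (suc k) (s≤s k<N)))) (ℚP.+-identityˡ 0ℚ)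

sumTo-last : ∀ N {f} → (∀ k → k ℕ.< N → f k ≡ 0ℚ) → sumTo (suc N) f ≡ f N
sumTo-last zero    f≗0 = ℚP.+-identityʳ _
sumTo-last (suc N) {f} f≗0 = begin
  f 0 + sumTo (suc N) (λ k → f (suc k)) ≡⟨ cong₂ _+_ (f≗0 0 (s≤s z≤n)) (sumTo-last N (λ k k<N → f≗0 (suc k) (s≤s k<N))) ⟩
  0ℚ + f (suc N)                         ≡⟨ ℚP.+-identityˡ (f (suc N)) ⟩
  f (suc N)                              ∎
  where open ≡-Reasoning

sumTo-telescope : ∀ N (f g : ℕ → ℚ) → (∀ k → k ℕ.< N → f (suc k) ≡ g k) →
                  sumTo (suc N) (λ k → f k - g k) ≡ f 0 - g N
sumTo-telescope zero    f g _     = ℚP.+-identityʳ (f 0 - g 0)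
sumTo-telescope (suc N) f g shift = begin
  f 0 - g 0 + sumTo (suc N) (λ k → f (suc k) - g (suc k)) ≡⟨ cong (λ t → f 0 - g 0 + t) (sumTo-telescope N (λ k → f (suc k)) (λ k → g (suc k)) (λ k k<N → shift (suc k) (s≤s k<N))) ⟩
  f 0 - g 0 + (f 1 - g (suc N))                            ≡⟨ cong (λ t → f 0 - g 0 + (t - g (suc N))) (shift 0 (s≤s z≤n)) ⟩
  f 0 - g 0 + (g 0 - g (suc N))                            ≡⟨ solve 3 (λ x y z → x :- y :+ (y :- z) := x :- z) refl (f 0) (g 0) (g (suc N)) ⟩
  f 0 - g (suc N)                                          ∎
  where
  open ≡-Reasoning
  open +-*-Solver

weightedSum-applyUpTo : ∀ N c g → weightedSum (applyUpTo c N) g ≡ sumTo N (λ k → c k * g k)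
weightedSum-applyUpTo zero    c g = refl
weightedSum-applyUpTo (suc N) c g =
  cong (λ t → c 0 * g 0 + t) (weightedSum-applyUpTo N (λ k → c (suc k)) (λ k → g (suc k)))

-- Hypergeometric coefficient sequences

-- The term ratio of 2F1(-r, -r-a; 1-a; z): if it holds, c k / c 0 is the k-th term of that series.
HypergeometricRatio : ℚ → ℕ → (ℕ → ℚ) → Set
HypergeometricRatio a r c = ∀ k → k ℕ.< r →
  c (suc k) * (fromℕ (suc k) * (1ℚ - a + fromℕ k)) ≡ c k * ((fromℕ r - fromℕ k) * (fromℕ r - fromℕ k + a))

HypergeometricRatio-reverse : ∀ {a r c} → HypergeometricRatio a r c → HypergeometricRatio (- a) r (λ k → c (r ℕ.∸ k))
HypergeometricRatio-reverse {a} {r} {c} ratio k k<r = begin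
  c i * (fromℕ (suc k) * (1ℚ - - a + K))       ≡⟨ cong (c i *_) (sym Rᵢ) ⟩
  c i * ((R - I) * (R - I + a))                ≡⟨ sym (ratio i i<r) ⟩
  c (suc i) * (fromℕ (suc i) * (1ℚ - a + I))   ≡⟨ cong (c (suc i) *_) (sym Rₖ) ⟩
  c (suc i) * ((R - K) * (R - K + - a))        ≡⟨ cong (λ t → c t * ((R - K) * (R - K + - a))) (sym r∸k≡1+i) ⟩
  c (r ℕ.∸ k) * ((R - K) * (R - K + - a))      ∎
  where
  open ≡-Reasoning
  open +-*-Solver
  i = r ℕ.∸ suc k
  R = fromℕ r
  I = fromℕ i
  K = fromℕ k
  r∸k≡1+i : r ℕ.∸ k ≡ suc i
  r∸k≡1+i = ℕP.+-∸-assoc 1 k<r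
  i<r : i ℕ.< r
  i<r = subst (ℕ._≤ r) r∸k≡1+i (ℕP.m∸n≤m r k)
  R≡I+K+1 : R ≡ I + (K + 1ℚ)
  R≡I+K+1 = trans (cong fromℕ (sym (ℕP.m∸n+n≡m k<r))) (trans (fromℕ-+ i (suc k)) (cong (λ x → I + x) (fromℕ-suc k)))
  Rₖ : (R - K) * (R - K + - a) ≡ fromℕ (suc i) * (1ℚ - a + I)
  Rₖ = begin
    (R - K) * (R - K + - a)                              ≡⟨ cong (λ x → (x - K) * (x - K + - a)) R≡I+K+1 ⟩
    (I + (K + 1ℚ) - K) * (I + (K + 1ℚ) - K + - a)        ≡⟨ solve 3 (λ I K a → (I :+ (K :+ con 1ℚ) :- K) :* (I :+ (K :+ con 1ℚ) :- K :+ :- a) := (I :+ con 1ℚ) :* (con 1ℚ :- a :+ I)) refl I K a ⟩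
    (I + 1ℚ) * (1ℚ - a + I)                              ≡⟨ cong (_* (1ℚ - a + I)) (sym (fromℕ-suc i)) ⟩
    fromℕ (suc i) * (1ℚ - a + I)                         ∎
  Rᵢ : (R - I) * (R - I + a) ≡ fromℕ (suc k) * (1ℚ - - a + K)
  Rᵢ = begin
    (R - I) * (R - I + a)                                ≡⟨ cong (λ x → (x - I) * (x - I + a)) R≡I+K+1 ⟩
    (I + (K + 1ℚ) - I) * (I + (K + 1ℚ) - I + a)          ≡⟨ solve 3 (λ I K a → (I :+ (K :+ con 1ℚ) :- I) :* (I :+ (K :+ con 1ℚ) :- I :+ a) := (K :+ con 1ℚ) :* (con 1ℚ :- :- a :+ K)) refl I K a ⟩
    (K + 1ℚ) * (1ℚ - - a + K)                            ≡⟨ cong (_* (1ℚ - - a + K)) (sym (fromℕ-suc k)) ⟩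
    fromℕ (suc k) * (1ℚ - - a + K)                       ∎

module HypergeometricPolynomial (a : ℚ) (r : ℕ) (c : ℕ → ℚ) (c-ratio : HypergeometricRatio a r c) where

  R : ℚ
  R = fromℕ r

  P : Poly
  P = applyUpTo c (suc r)

  -- T j is the j-th derivative of P at 1.
  T : ℕ → ℚ
  T j = sumTo (suc r) (λ k → c k * fromℕ k ↓ j)

  -- (2r - j) k↓(j+1) = (φ k - ψ k) + C k↓j, where φ (k + 1) = ψ k by the term ratio,
  -- so the φ - ψ part telescopes to φ 0 - ψ r = 0.
  T-recurrence : ∀ j → (R + R - fromℕ j) * T (suc j) ≡ (R - fromℕ j) * (R - fromℕ j + a) * T j
  T-recurrence j = begin
    (R + R - J) * T (suc j)
      ≡⟨ sym (sumTo-*ˡ (suc r) (R + R - J) (λ k → c k * fromℕ k ↓ suc j)) ⟩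
    sumTo (suc r) (λ k → (R + R - J) * (c k * fromℕ k ↓ suc j))
      ≡⟨ sumTo-cong (suc r) (λ k _ → split k) ⟩
    sumTo (suc r) (λ k → (φ k - ψ k) + C * (c k * fromℕ k ↓ j))
      ≡⟨ sumTo-linear (suc r) (λ k → φ k - ψ k) (λ k → c k * fromℕ k ↓ j) C ⟩
    sumTo (suc r) (λ k → φ k - ψ k) + C * T j
      ≡⟨ cong (_+ C * T j) (sumTo-telescope r φ ψ φ-shift) ⟩
    φ 0 - ψ r + C * T j
      ≡⟨ cong₂ (λ x y → x - y + C * T j) φ-0 ψ-r ⟩
    0ℚ - 0ℚ + C * T j
      ≡⟨ ℚP.+-identityˡ (C * T j) ⟩
    C * T j ∎
    where
    open ≡-Reasoning
    open +-*-Solver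
    J = fromℕ j
    C = (R - J) * (R - J + a)
    φ ψ : ℕ → ℚ
    φ k = c k * ((fromℕ k - a) * fromℕ k ↓ suc j)
    ψ k = c k * ((R - fromℕ k) * (R - fromℕ k + a) * fromℕ k ↓ j)

    split : ∀ k → (R + R - J) * (c k * fromℕ k ↓ suc j) ≡ (φ k - ψ k) + C * (c k * fromℕ k ↓ j)
    split k = solve 6 (λ R J a c K f →
        (R :+ R :- J) :* (c :* (f :* (K :- J)))
      := (c :* ((K :- a) :* (f :* (K :- J))) :- c :* ((R :- K) :* (R :- K :+ a) :* f)) :+ (R :- J) :* (R :- J :+ a) :* (c :* f))
      refl R J a (c k) (fromℕ k) (fromℕ k ↓ j)

    φ-shift : ∀ k → k ℕ.< r → φ (suc k) ≡ ψ k
    φ-shift k k<r = begin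
      c (suc k) * ((fromℕ (suc k) - a) * fromℕ (suc k) ↓ suc j)
        ≡⟨ cong₂ (λ x y → c (suc k) * ((x - a) * y)) (fromℕ-suc k) (fromℕ-suc↓suc k j) ⟩
      c (suc k) * ((fromℕ k + 1ℚ - a) * (fromℕ (suc k) * fromℕ k ↓ j))
        ≡⟨ solve 5 (λ c K a S f → c :* ((K :+ con 1ℚ :- a) :* (S :* f)) := c :* (S :* (con 1ℚ :- a :+ K)) :* f) refl (c (suc k)) (fromℕ k) a (fromℕ (suc k)) (fromℕ k ↓ j) ⟩
      c (suc k) * (fromℕ (suc k) * (1ℚ - a + fromℕ k)) * fromℕ k ↓ j
        ≡⟨ cong (_* fromℕ k ↓ j) (c-ratio k k<r) ⟩
      c k * ((R - fromℕ k) * (R - fromℕ k + a)) * fromℕ k ↓ j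
        ≡⟨ ℚP.*-assoc (c k) _ _ ⟩
      ψ k ∎

    φ-0 : φ 0 ≡ 0ℚ
    φ-0 = begin
      c 0 * ((0ℚ - a) * 0ℚ ↓ suc j) ≡⟨ cong (λ x → c 0 * ((0ℚ - a) * x)) (0↓suc j) ⟩
      c 0 * ((0ℚ - a) * 0ℚ)          ≡⟨ solve 2 (λ c a → c :* ((con 0ℚ :- a) :* con 0ℚ) := con 0ℚ) refl (c 0) a ⟩
      0ℚ                             ∎

    ψ-r : ψ r ≡ 0ℚ
    ψ-r = begin
      c r * ((R - R) * (R - R + a) * R ↓ j) ≡⟨ cong (λ x → c r * (x * (x + a) * R ↓ j)) (ℚP.+-inverseʳ R) ⟩
      c r * (0ℚ * (0ℚ + a) * R ↓ j)         ≡⟨ solve 3 (λ c a f → c :* (con 0ℚ :* (con 0ℚ :+ a) :* f) := con 0ℚ) refl (c r) a (R ↓ j) ⟩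
      0ℚ                                    ∎

  T-top : T r ≡ c r * fromℕ (r !)
  T-top = begin
    T r             ≡⟨ sumTo-last r (λ k k<r → trans (cong (c k *_) (fromℕ↓-vanishes k<r)) (ℚP.*-zeroʳ (c k))) ⟩
    c r * R ↓ r     ≡⟨ cong (c r *_) (fromℕ↓self r) ⟩
    c r * fromℕ (r !) ∎
    where open ≡-Reasoning

  T-above : ∀ {j} → r ℕ.< j → T j ≡ 0ℚ
  T-above r<j = sumTo-vanishes (suc r) (λ k k≤r →
    trans (cong (c k *_) (fromℕ↓-vanishes (ℕP.<-≤-trans k≤r r<j))) (ℚP.*-zeroʳ (c k)))

  c-closed : ∀ k → k ≤ r → c k * (1ℚ - a) ↑ k * fromℕ (k !) ≡ c 0 * R ↓ k * (R + a) ↓ k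
  c-closed zero    _   = refl
  c-closed (suc k) k<r = begin
    c (suc k) * ((1ℚ - a) ↑ k * (1ℚ - a + K)) * fromℕ (suc k !)
      ≡⟨ cong (c (suc k) * ((1ℚ - a) ↑ k * (1ℚ - a + K)) *_) (fromℕ-* (suc k) (k !)) ⟩
    c (suc k) * ((1ℚ - a) ↑ k * (1ℚ - a + K)) * (fromℕ (suc k) * fromℕ (k !))
      ≡⟨ solve 5 (λ c ρ z S f → c :* (ρ :* z) :* (S :* f) := c :* (S :* z) :* (ρ :* f)) refl (c (suc k)) ((1ℚ - a) ↑ k) (1ℚ - a + K) (fromℕ (suc k)) (fromℕ (k !)) ⟩
    c (suc k) * (fromℕ (suc k) * (1ℚ - a + K)) * ((1ℚ - a) ↑ k * fromℕ (k !))
      ≡⟨ cong (_* ((1ℚ - a) ↑ k * fromℕ (k !))) (c-ratio k k<r) ⟩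
    c k * ((R - K) * (R - K + a)) * ((1ℚ - a) ↑ k * fromℕ (k !))
      ≡⟨ solve 5 (λ c X Y ρ f → c :* (X :* Y) :* (ρ :* f) := (c :* ρ :* f) :* (X :* Y)) refl (c k) (R - K) (R - K + a) ((1ℚ - a) ↑ k) (fromℕ (k !)) ⟩
    c k * (1ℚ - a) ↑ k * fromℕ (k !) * ((R - K) * (R - K + a))
      ≡⟨ cong (_* ((R - K) * (R - K + a))) (c-closed k (ℕP.<⇒≤ k<r)) ⟩
    c 0 * R ↓ k * (R + a) ↓ k * ((R - K) * (R - K + a))
      ≡⟨ solve 6 (λ c f g R K a → c :* f :* g :* ((R :- K) :* (R :- K :+ a)) := c :* (f :* (R :- K)) :* (g :* (R :+ a :- K))) refl (c 0) (R ↓ k) ((R + a) ↓ k) R K a ⟩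
    c 0 * R ↓ suc k * (R + a) ↓ suc k ∎
    where
    open ≡-Reasoning
    open +-*-Solver
    K = fromℕ k

  c-top : c r * (1ℚ - a) ↑ r ≡ c 0 * (R + a) ↓ r
  c-top = *-cancelˡ-≢0 (fromℕ (r !)) (fromℕ-!≢0 r) (begin
    fromℕ (r !) * (c r * (1ℚ - a) ↑ r)  ≡⟨ ℚP.*-comm (fromℕ (r !)) _ ⟩
    c r * (1ℚ - a) ↑ r * fromℕ (r !)    ≡⟨ c-closed r ℕP.≤-refl ⟩
    c 0 * R ↓ r * (R + a) ↓ r           ≡⟨ cong (λ x → c 0 * x * (R + a) ↓ r) (fromℕ↓self r) ⟩
    c 0 * fromℕ (r !) * (R + a) ↓ r     ≡⟨ solve 3 (λ x y z → x :* y :* z := y :* (x :* z)) refl (c 0) (fromℕ (r !)) ((R + a) ↓ r) ⟩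
    fromℕ (r !) * (c 0 * (R + a) ↓ r)   ∎)
    where
    open ≡-Reasoning
    open +-*-Solver

  -- Descending induction on j via T-recurrence, from the top value T r = c r * r!.
  T-closed : (∀ t → fromℕ (suc t) + a ≢ 0ℚ) → ∀ i j → j ℕ.+ i ≡ r →
             T j * fromℕ (i !) * (1ℚ - a) ↑ r ≡ fromℕ ((r ℕ.+ i) !) * c 0 * (R + a) ↓ j
  T-closed _ zero j j+0≡r = subst (λ j → T j * 1ℚ * (1ℚ - a) ↑ r ≡ fromℕ ((r ℕ.+ 0) !) * c 0 * (R + a) ↓ j)
                                 (trans (sym j+0≡r) (ℕP.+-identityʳ j)) (begin
    T r * 1ℚ * (1ℚ - a) ↑ r                  ≡⟨ cong (λ x → x * 1ℚ * (1ℚ - a) ↑ r) T-top ⟩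
    c r * fromℕ (r !) * 1ℚ * (1ℚ - a) ↑ r     ≡⟨ solve 3 (λ x y z → x :* y :* con 1ℚ :* z := y :* (x :* z)) refl (c r) (fromℕ (r !)) ((1ℚ - a) ↑ r) ⟩
    fromℕ (r !) * (c r * (1ℚ - a) ↑ r)        ≡⟨ cong (fromℕ (r !) *_) c-top ⟩
    fromℕ (r !) * (c 0 * (R + a) ↓ r)         ≡⟨ sym (ℚP.*-assoc (fromℕ (r !)) (c 0) _) ⟩
    fromℕ (r !) * c 0 * (R + a) ↓ r           ≡⟨ cong (λ n → fromℕ (n !) * c 0 * (R + a) ↓ r) (sym (ℕP.+-identityʳ r)) ⟩
    fromℕ ((r ℕ.+ 0) !) * c 0 * (R + a) ↓ r   ∎)
    where
    open ≡-Reasoning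
    open +-*-Solver
  T-closed nz (suc i) j j+1+i≡r = *-cancelˡ-≢0 (S * (S + a)) (*-≢0 (fromℕ-suc≢0 i) (nz i)) (begin
    S * (S + a) * (T j * fromℕ (suc i !) * ρ)     ≡⟨ cong (λ x → S * (S + a) * (T j * x * ρ)) (fromℕ-* (suc i) (i !)) ⟩
    S * (S + a) * (T j * (S * I) * ρ)             ≡⟨ solve 5 (λ S a T I ρ → S :* (S :+ a) :* (T :* (S :* I) :* ρ) := S :* (S :* (S :+ a) :* T) :* I :* ρ) refl S a (T j) I ρ ⟩
    S * (S * (S + a) * T j) * I * ρ               ≡⟨ cong (λ x → S * x * I * ρ) (sym recurrence) ⟩
    S * (W * T (suc j)) * I * ρ                   ≡⟨ solve 5 (λ S W T I ρ → S :* (W :* T) :* I :* ρ := S :* W :* (T :* I :* ρ)) refl S W (T (suc j)) I ρ ⟩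
    S * W * (T (suc j) * I * ρ)                   ≡⟨ cong (S * W *_) (T-closed nz i (suc j) (trans (sym (ℕP.+-suc j i)) j+1+i≡r)) ⟩
    S * W * (X * c 0 * ((R + a) ↓ j * (R + a - J))) ≡⟨ cong (λ x → S * W * (X * c 0 * ((R + a) ↓ j * x))) R+a-J≡S+a ⟩
    S * W * (X * c 0 * ((R + a) ↓ j * (S + a)))   ≡⟨ solve 6 (λ S W X c f a → S :* W :* (X :* c :* (f :* (S :+ a))) := S :* (S :+ a) :* (W :* X :* c :* f)) refl S W X (c 0) ((R + a) ↓ j) a ⟩
    S * (S + a) * (W * X * c 0 * (R + a) ↓ j)     ≡⟨ cong (λ x → S * (S + a) * (x * c 0 * (R + a) ↓ j)) (sym factorial-step) ⟩
    S * (S + a) * (fromℕ ((r ℕ.+ suc i) !) * c 0 * (R + a) ↓ j) ∎)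
    where
    open ≡-Reasoning
    open +-*-Solver
    ρ = (1ℚ - a) ↑ r
    J = fromℕ j
    S = fromℕ (suc i)
    I = fromℕ (i !)
    W = R + S
    X = fromℕ ((r ℕ.+ i) !)
    R-J≡S : R - J ≡ S
    R-J≡S = trans (cong (_- J) (trans (cong fromℕ (sym j+1+i≡r)) (fromℕ-+ j (suc i))))
                  (solve 2 (λ J S → J :+ S :- J := S) refl J S)
    R+a-J≡S+a : R + a - J ≡ S + a
    R+a-J≡S+a = trans (solve 3 (λ R a J → R :+ a :- J := R :- J :+ a) refl R a J) (cong (_+ a) R-J≡S)
    recurrence : W * T (suc j) ≡ S * (S + a) * T j
    recurrence = begin
      W * T (suc j)                    ≡⟨ cong (λ x → (R + x) * T (suc j)) (sym R-J≡S) ⟩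
      (R + (R - J)) * T (suc j)        ≡⟨ cong (_* T (suc j)) (solve 2 (λ R J → R :+ (R :- J) := R :+ R :- J) refl R J) ⟩
      (R + R - J) * T (suc j)          ≡⟨ T-recurrence j ⟩
      (R - J) * (R - J + a) * T j      ≡⟨ cong (λ x → x * (x + a) * T j) R-J≡S ⟩
      S * (S + a) * T j                ∎
    factorial-step : fromℕ ((r ℕ.+ suc i) !) ≡ W * X
    factorial-step = begin
      fromℕ ((r ℕ.+ suc i) !)           ≡⟨ cong (λ n → fromℕ (n !)) (ℕP.+-suc r i) ⟩
      fromℕ (suc (r ℕ.+ i) !)           ≡⟨ fromℕ-* (suc (r ℕ.+ i)) ((r ℕ.+ i) !) ⟩
      fromℕ (suc (r ℕ.+ i)) * X         ≡⟨ cong (λ n → fromℕ n * X) (sym (ℕP.+-suc r i)) ⟩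
      fromℕ (r ℕ.+ suc i) * X           ≡⟨ cong (_* X) (fromℕ-+ r (suc i)) ⟩
      W * X                             ∎

  factorial-coeff : ∀ d j → fromℕ (j !) * coeff (P ∘ₚ oneMinus d) j ≡ (- fromℕ d) ^ℚ j * T j
  factorial-coeff d j = trans (coeff-∘ₚ-oneMinus d P j)
                              (cong ((- fromℕ d) ^ℚ j *_) (weightedSum-applyUpTo (suc r) c (λ k → fromℕ k ↓ j)))

  coeff-above : ∀ d {j} → r ℕ.< j → coeff (P ∘ₚ oneMinus d) j ≡ 0ℚ
  coeff-above d {j} r<j = *-cancelˡ-≢0 (fromℕ (j !)) (fromℕ-!≢0 j) (begin
    fromℕ (j !) * coeff (P ∘ₚ oneMinus d) j ≡⟨ factorial-coeff d j ⟩
    (- fromℕ d) ^ℚ j * T j                     ≡⟨ cong ((- fromℕ d) ^ℚ j *_) (T-above r<j) ⟩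
    (- fromℕ d) ^ℚ j * 0ℚ                      ≡⟨ ℚP.*-zeroʳ ((- fromℕ d) ^ℚ j) ⟩
    0ℚ                                         ≡⟨ sym (ℚP.*-zeroʳ (fromℕ (j !))) ⟩
    fromℕ (j !) * 0ℚ                           ∎)
    where open ≡-Reasoning

  -- M = (2r - j)! / (j! (r - j)!) is an integer because j! (r - j)! divides r!.
  coeff-closed : (∀ t → fromℕ (suc t) + a ≢ 0ℚ) → ∀ d j → j ≤ r →
    ∃[ M ] coeff (P ∘ₚ oneMinus d) j * (1ℚ - a) ↑ r ≡ (- fromℕ d) ^ℚ j * fromℕ M * c 0 * (R + a) ↓ j
  coeff-closed nz d j j≤r with ℕ∣.∣-trans (k![n∸k]!∣n! j≤r) (ℕ∣.m≤n⇒m!∣n! (ℕP.m≤m+n r (r ℕ.∸ j)))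
  ... | divides M [r+i]!≡M*j!i! = M , *-cancelˡ-≢0 (J! * I!) (*-≢0 (fromℕ-!≢0 j) (fromℕ-!≢0 i)) (begin
    J! * I! * (γ * ρ)                        ≡⟨ solve 4 (λ J I γ ρ → J :* I :* (γ :* ρ) := J :* γ :* I :* ρ) refl J! I! γ ρ ⟩
    J! * γ * I! * ρ                          ≡⟨ cong (λ x → x * I! * ρ) (factorial-coeff d j) ⟩
    Dʲ * T j * I! * ρ                        ≡⟨ solve 4 (λ P T I ρ → P :* T :* I :* ρ := P :* (T :* I :* ρ)) refl Dʲ (T j) I! ρ ⟩
    Dʲ * (T j * I! * ρ)                      ≡⟨ cong (Dʲ *_) (T-closed nz i j (ℕP.m+[n∸m]≡n j≤r)) ⟩
    Dʲ * (fromℕ ((r ℕ.+ i) !) * c 0 * f)     ≡⟨ cong (λ x → Dʲ * (x * c 0 * f)) [r+i]!≡M*J!*I! ⟩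
    Dʲ * (fromℕ M * (J! * I!) * c 0 * f)     ≡⟨ solve 6 (λ P M J I c f → P :* (M :* (J :* I) :* c :* f) := J :* I :* (P :* M :* c :* f)) refl Dʲ (fromℕ M) J! I! (c 0) f ⟩
    J! * I! * (Dʲ * fromℕ M * c 0 * f)       ∎)
    where
    open ≡-Reasoning
    open +-*-Solver
    i = r ℕ.∸ j
    J! = fromℕ (j !)
    I! = fromℕ (i !)
    γ = coeff (P ∘ₚ oneMinus d) j
    ρ = (1ℚ - a) ↑ r
    Dʲ = (- fromℕ d) ^ℚ j
    f = (R + a) ↓ j
    [r+i]!≡M*J!*I! : fromℕ ((r ℕ.+ i) !) ≡ fromℕ M * (J! * I!)
    [r+i]!≡M*J!*I! = trans (cong fromℕ [r+i]!≡M*j!i!) (trans (fromℕ-* M _) (cong (fromℕ M *_) (fromℕ-* (j !) (i !))))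

-- Integrality and coprimality

Integral : ℚ → Set
Integral x = ∃[ z ] x ≡ fromℤ z

CoprimeIntegral : ℕ → ℚ → Set
CoprimeIntegral b x = ∃[ z ] x ≡ fromℤ z × Coprime b ∣ z ∣

Integral-fromℕ : ∀ k → Integral (fromℕ k)
Integral-fromℕ k = + k , refl

Integral-+ : ∀ {x y} → Integral x → Integral y → Integral (x + y)
Integral-+ (u , refl) (v , refl) = u ℤ.+ v , sym (fromℤ-+ u v)

Integral-* : ∀ {x y} → Integral x → Integral y → Integral (x * y)
Integral-* (u , refl) (v , refl) = u ℤ.* v , sym (fromℤ-* u v)

Integral-neg : ∀ {x} → Integral x → Integral (- x)
Integral-neg (u , refl) = ℤ.- u , sym (fromℤ-neg u)

Integral-^ : ∀ {x} k → Integral x → Integral (x ^ℚ k)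
Integral-^ zero    _  = Integral-fromℕ 1
Integral-^ (suc k) ix = Integral-* ix (Integral-^ k ix)

coprime-*ʳ : ∀ {a b c} → Coprime a b → Coprime a c → Coprime a (b ℕ.* c)
coprime-*ʳ {a} {b} a⊥b a⊥c {e} (e∣a , e∣bc) = a⊥c (e∣a , Coprimality.coprime-divisor e⊥b e∣bc)
  where
  e⊥b : Coprime e b
  e⊥b (f∣e , f∣b) = a⊥b (ℕ∣.∣-trans f∣e e∣a , f∣b)

coprime-^ˡ : ∀ {a b} k → Coprime a b → Coprime (a ^ k) b
coprime-^ˡ {b = b} zero _ = Coprimality.1-coprimeTo b
coprime-^ˡ (suc k) a⊥b = Coprimality.sym (coprime-*ʳ (Coprimality.sym a⊥b) (Coprimality.sym (coprime-^ˡ k a⊥b)))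

CoprimeIntegral-* : ∀ {b x y} → CoprimeIntegral b x → CoprimeIntegral b y → CoprimeIntegral b (x * y)
CoprimeIntegral-* (u , refl , b⊥u) (v , refl , b⊥v) =
  u ℤ.* v , sym (fromℤ-* u v) , subst (Coprime _) (sym (ℤP.abs-* u v)) (coprime-*ʳ b⊥u b⊥v)

CoprimeIntegral-+-multiple : ∀ {b x y} → CoprimeIntegral b x → Integral y → CoprimeIntegral b (x + fromℕ b * y)
CoprimeIntegral-+-multiple {b} (u , refl , b⊥u) (v , refl) =
  u ℤ.+ + b ℤ.* v , sym (trans (fromℤ-+ u _) (cong (λ t → fromℤ u + t) (fromℤ-* (+ b) v))) , b⊥u+bv
  where
  b⊥u+bv : Coprime b ∣ u ℤ.+ + b ℤ.* v ∣
  b⊥u+bv {e} (e∣b , e∣u+bv) = b⊥u (e∣b , ℤ∣.∣⇒∣ᵤ {+ e} {u} (ℤ∣.∣m+n∣n⇒∣m (ℤ∣.∣ᵤ⇒∣ {+ e} {u ℤ.+ + b ℤ.* v} e∣u+bv) (ℤ∣.∣m⇒∣m*n v (ℤ∣.∣ᵤ⇒∣ {+ e} {+ b} e∣b))))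

CoprimeIntegral-^ : ∀ {b x} k → CoprimeIntegral b x → CoprimeIntegral (b ^ k) x
CoprimeIntegral-^ k (u , x≡u , b⊥u) = u , x≡u , coprime-^ˡ k b⊥u

CoprimeIntegral⇒Integral : ∀ {b x} → CoprimeIntegral b x → Integral x
CoprimeIntegral⇒Integral (z , x≡z , _) = z , x≡z

*-↧≡↥ : ∀ q → q * fromℤ (↧ q) ≡ fromℤ (↥ q)
*-↧≡↥ q@(mkℚ n d _) = ℚP.toℚᵘ-injective (begin
  ℚ.toℚᵘ (q * fromℤ (↧ q))                   ≈⟨ ℚP.toℚᵘ-homo-* q (fromℤ (↧ q)) ⟩
  ℚᵘ.mkℚᵘ n d ℚᵘ.* ℚ.toℚᵘ (fromℤ (↧ q))      ≈⟨ ℚᵘP.*-cong (ℚᵘP.≃-refl {ℚᵘ.mkℚᵘ n d}) (toℚᵘ-fromℤ (↧ q)) ⟩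
  ℚᵘ.mkℚᵘ n d ℚᵘ.* ℚᵘ.mkℚᵘ (↧ q) 0           ≈⟨ ℚᵘ.*≡* (trans (ℤP.*-identityʳ (n ℤ.* ↧ q)) (cong (n ℤ.*_) (sym (ℤP.*-identityʳ (↧ q))))) ⟩
  ℚᵘ.mkℚᵘ n 0                                ≈⟨ ℚᵘP.≃-sym (toℚᵘ-fromℤ n) ⟩
  ℚ.toℚᵘ (fromℤ n)                           ∎)
  where open ℚᵘP.≃-Reasoning

-- Clearing the denominator of q turns the equation into b ∣ ↥ q * u in ℤ, and u is prime to b.
numerator-divisible : ∀ {b q x y} → CoprimeIntegral b x → Integral y → q * x ≡ fromℕ b * y → (+ b) ∣ ↥ q
numerator-divisible {b} {q} (u , refl , b⊥u) (v , refl) qu≡bv =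
  Coprimality.coprime-divisor b⊥u (divides ∣ v ℤ.* ↧ q ∣ (begin
    ∣ u ∣ ℕ.* ∣ ↥ q ∣           ≡⟨ sym (ℤP.abs-* u (↥ q)) ⟩
    ∣ u ℤ.* ↥ q ∣               ≡⟨ cong ∣_∣ (fromℤ-injective (u ℤ.* ↥ q) (+ b ℤ.* (v ℤ.* ↧ q)) ↥q*u≡b*v*↧q) ⟩
    ∣ + b ℤ.* (v ℤ.* ↧ q) ∣      ≡⟨ ℤP.abs-* (+ b) (v ℤ.* ↧ q) ⟩
    b ℕ.* ∣ v ℤ.* ↧ q ∣          ≡⟨ ℕP.*-comm b _ ⟩
    ∣ v ℤ.* ↧ q ∣ ℕ.* b          ∎))
  where
  open ≡-Reasoning
  ↥q*u≡b*v*↧q : fromℤ (u ℤ.* ↥ q) ≡ fromℤ (+ b ℤ.* (v ℤ.* ↧ q))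
  ↥q*u≡b*v*↧q = begin
    fromℤ (u ℤ.* ↥ q)                       ≡⟨ fromℤ-* u (↥ q) ⟩
    fromℤ u * fromℤ (↥ q)                   ≡⟨ cong (fromℤ u *_) (sym (*-↧≡↥ q)) ⟩
    fromℤ u * (q * fromℤ (↧ q))             ≡⟨ solve 3 (λ u q D → u :* (q :* D) := (q :* u) :* D) refl (fromℤ u) q (fromℤ (↧ q)) ⟩
    q * fromℤ u * fromℤ (↧ q)               ≡⟨ cong (_* fromℤ (↧ q)) qu≡bv ⟩
    fromℕ b * fromℤ v * fromℤ (↧ q)         ≡⟨ ℚP.*-assoc (fromℕ b) _ _ ⟩
    fromℕ b * (fromℤ v * fromℤ (↧ q))       ≡⟨ cong (fromℕ b *_) (sym (fromℤ-* v (↧ q))) ⟩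
    fromℕ b * fromℤ (v ℤ.* ↧ q)             ≡⟨ sym (fromℤ-* (+ b) _) ⟩
    fromℤ (+ b ℤ.* (v ℤ.* ↧ q))             ∎
    where open +-*-Solver

CoprimeIntegral-↑ : ∀ {d n x} → d ∣ₙ n → CoprimeIntegral d (fromℕ n * x) → ∀ k → CoprimeIntegral d (fromℕ n ^ℚ k * x ↑ k)
CoprimeIntegral-↑ {d} _ _ zero = + 1 , refl , Coprimality.sym (Coprimality.1-coprimeTo d)
CoprimeIntegral-↑ {d} {n} {x} (divides e n≡e*d) nx (suc k) =
  subst (CoprimeIntegral d) step
        (CoprimeIntegral-* (CoprimeIntegral-↑ {d} {n} {x} (divides e n≡e*d) nx k)
                           (CoprimeIntegral-+-multiple nx (Integral-fromℕ (k ℕ.* e))))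
  where
  open ≡-Reasoning
  open +-*-Solver
  N = fromℕ n
  K = fromℕ k
  D = fromℕ d
  kn≡d*ke : D * fromℕ (k ℕ.* e) ≡ K * N
  kn≡d*ke = begin
    D * fromℕ (k ℕ.* e)       ≡⟨ cong (D *_) (fromℕ-* k e) ⟩
    D * (K * fromℕ e)         ≡⟨ solve 3 (λ D K E → D :* (K :* E) := K :* (E :* D)) refl D K (fromℕ e) ⟩
    K * (fromℕ e * D)         ≡⟨ cong (K *_) (sym (trans (cong fromℕ n≡e*d) (fromℕ-* e d))) ⟩
    K * N                     ∎
  step : N ^ℚ k * x ↑ k * (N * x + D * fromℕ (k ℕ.* e)) ≡ N ^ℚ suc k * x ↑ suc k
  step = begin
    N ^ℚ k * x ↑ k * (N * x + D * fromℕ (k ℕ.* e)) ≡⟨ cong (λ t → N ^ℚ k * x ↑ k * (N * x + t)) kn≡d*ke ⟩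
    N ^ℚ k * x ↑ k * (N * x + K * N)               ≡⟨ solve 5 (λ N P ρ x K → P :* ρ :* (N :* x :+ K :* N) := N :* P :* (ρ :* (x :+ K))) refl N (N ^ℚ k) (x ↑ k) x K ⟩
    N * N ^ℚ k * (x ↑ k * (x + K))                 ∎

Integral-↓ : ∀ {n x} → Integral (fromℕ n * x) → ∀ k → Integral (fromℕ n ^ℚ k * x ↓ k)
Integral-↓ _ zero = Integral-fromℕ 1
Integral-↓ {n} {x} nx (suc k) =
  subst Integral step (Integral-* (Integral-↓ {n} {x} nx k) (Integral-+ nx (Integral-neg (Integral-fromℕ (k ℕ.* n)))))
  where
  open ≡-Reasoning
  open +-*-Solver
  N = fromℕ n
  K = fromℕ k
  step : N ^ℚ k * x ↓ k * (N * x + - fromℕ (k ℕ.* n)) ≡ N ^ℚ suc k * x ↓ suc k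
  step = begin
    N ^ℚ k * x ↓ k * (N * x + - fromℕ (k ℕ.* n)) ≡⟨ cong (λ t → N ^ℚ k * x ↓ k * (N * x + - t)) (fromℕ-* k n) ⟩
    N ^ℚ k * x ↓ k * (N * x + - (K * N))         ≡⟨ solve 5 (λ N P f x K → P :* f :* (N :* x :+ :- (K :* N)) := N :* P :* (f :* (x :- K))) refl N (N ^ℚ k) (x ↓ k) x K ⟩
    N * N ^ℚ k * (x ↓ k * (x - K))               ∎

^ℚ-split : ∀ x {j r} → j ≤ r → x ^ℚ r ≡ x ^ℚ j * x ^ℚ (r ℕ.∸ j)
^ℚ-split x {j} {r} j≤r = trans (cong (x ^ℚ_) (sym (ℕP.m+[n∸m]≡n j≤r))) (^ℚ-+ x j (r ℕ.∸ j))

-- Writing n = e d, the right-hand side is d^r (-1)^j e^(r-j) V.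
numerator-divisible-^ : ∀ {d n r j q U V} → d ∣ₙ n → j ≤ r → CoprimeIntegral d U → Integral V →
  q * U ≡ (- fromℕ d) ^ℚ j * fromℕ n ^ℚ (r ℕ.∸ j) * V → (+ (d ^ r)) ∣ ↥ q
numerator-divisible-^ {d} {n} {r} {j} {q} {U} {V} (divides e n≡e*d) j≤r d⊥U V∈ℤ qU≡ =
  numerator-divisible {q = q} (CoprimeIntegral-^ r d⊥U) cofactor∈ℤ (begin
    q * U                                           ≡⟨ qU≡ ⟩
    (- D) ^ℚ j * N ^ℚ i * V                          ≡⟨ cong₂ (λ x y → x ^ℚ j * y ^ℚ i * V) -D≡-1*D N≡E*D ⟩
    (- 1ℚ * D) ^ℚ j * (E * D) ^ℚ i * V               ≡⟨ cong₂ (λ x y → x * y * V) (^ℚ-* (- 1ℚ) D j) (^ℚ-* E D i) ⟩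
    (- 1ℚ) ^ℚ j * D ^ℚ j * (E ^ℚ i * D ^ℚ i) * V      ≡⟨ solve 5 (λ s Dj Ei Di V → s :* Dj :* (Ei :* Di) :* V := Dj :* Di :* (s :* Ei :* V)) refl ((- 1ℚ) ^ℚ j) (D ^ℚ j) (E ^ℚ i) (D ^ℚ i) V ⟩
    D ^ℚ j * D ^ℚ i * ((- 1ℚ) ^ℚ j * E ^ℚ i * V)     ≡⟨ cong (_* ((- 1ℚ) ^ℚ j * E ^ℚ i * V)) Dʲ*Dⁱ≡dʳ ⟩
    fromℕ (d ^ r) * ((- 1ℚ) ^ℚ j * E ^ℚ i * V)       ∎)
  where
  open ≡-Reasoning
  open +-*-Solver
  i = r ℕ.∸ j
  D = fromℕ d
  E = fromℕ e
  N = fromℕ n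
  cofactor∈ℤ : Integral ((- 1ℚ) ^ℚ j * E ^ℚ i * V)
  cofactor∈ℤ = Integral-* (Integral-* (Integral-^ j (Integral-neg (Integral-fromℕ 1))) (Integral-^ i (Integral-fromℕ e))) V∈ℤ
  -D≡-1*D : - D ≡ - 1ℚ * D
  -D≡-1*D = solve 1 (λ D → :- D := :- con 1ℚ :* D) refl D
  N≡E*D : N ≡ E * D
  N≡E*D = trans (cong fromℕ n≡e*d) (fromℕ-* e d)
  Dʲ*Dⁱ≡dʳ : D ^ℚ j * D ^ℚ i ≡ fromℕ (d ^ r)
  Dʲ*Dⁱ≡dʳ = trans (sym (^ℚ-split D j≤r)) (fromℕ-^ d r)

-- The polynomials X and Y

*-frac : ∀ m n → n ≢ 0 → fromℕ n * frac m n ≡ fromℕ m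
*-frac m n n≢0 = begin
  N * (M * inv N)   ≡⟨ solve 3 (λ N M i → N :* (M :* i) := M :* (N :* i)) refl N M (inv N) ⟩
  M * (N * inv N)   ≡⟨ cong (M *_) (*-inv N (fromℕ-≢0 n n≢0)) ⟩
  M * 1ℚ            ≡⟨ ℚP.*-identityʳ M ⟩
  M                 ∎
  where
  open ≡-Reasoning
  open +-*-Solver
  N = fromℕ n
  M = fromℕ m

frac-not-integral : ∀ {m n} → 2 ≤ n → gcd m n ≡ 1 → ¬ Integral (frac m n)
frac-not-integral {m} {n} 2≤n gcd≡1 (z , m/n≡z) = ℕP.<⇒≢ 2≤n (sym n≡1)
  where
  m≡n*z : + m ≡ + n ℤ.* z
  m≡n*z = fromℤ-injective (+ m) (+ n ℤ.* z)
    (trans (sym (*-frac m n (ℕP.n>0⇒n≢0 (ℕP.<-trans (s≤s z≤n) 2≤n))))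
           (trans (cong (fromℕ n *_) m/n≡z) (sym (fromℤ-* (+ n) z))))
  n∣m : n ∣ₙ m
  n∣m = divides ∣ z ∣ (trans (cong ∣_∣ m≡n*z) (trans (ℤP.abs-* (+ n) z) (ℕP.*-comm n ∣ z ∣)))
  n≡1 : n ≡ 1
  n≡1 = ℕ∣.∣1⇒≡1 (subst (n ∣ₙ_) gcd≡1 (gcd-greatest n∣m ℕ∣.∣-refl))

applyDownFrom≡applyUpTo : ∀ {A : Set} (f : ℕ → A) N → applyDownFrom f N ≡ applyUpTo (λ k → f (N ℕ.∸ suc k)) N
applyDownFrom≡applyUpTo f zero    = refl
applyDownFrom≡applyUpTo f (suc N) = cong (f N ∷_) (applyDownFrom≡applyUpTo f N)

All-coeff : ∀ {P : ℚ → Set} p → (∀ j → P (coeff p j)) → All P p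
All-coeff []      _ = []
All-coeff (a ∷ p) f = f 0 ∷ All-coeff p (λ j → f (suc j))

module _ {m n r : ℕ} (2≤n : 2 ≤ n) (gcd≡1 : gcd m n ≡ 1) where

  private
    a = frac m n
    h = hterm m n r
    N = fromℕ n
    R = fromℕ r

    N*a≡m : N * a ≡ fromℕ m
    N*a≡m = *-frac m n (ℕP.n>0⇒n≢0 (ℕP.<-trans (s≤s z≤n) 2≤n))

    a≢integer : ∀ z → a ≢ fromℤ z
    a≢integer z a≡z = frac-not-integral {m} {n} 2≤n gcd≡1 (z , a≡z)

    1-a+k≢0 : ∀ k → 1ℚ - a + fromℕ k ≢ 0ℚ
    1-a+k≢0 k eq = a≢integer (+ suc k) (sym (x∙y⁻¹≈ε⇒x≈y (fromℕ (suc k)) a (begin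
      fromℕ (suc k) - a     ≡⟨ cong (_- a) (fromℕ-suc k) ⟩
      fromℕ k + 1ℚ - a      ≡⟨ solve 2 (λ K a → K :+ con 1ℚ :- a := con 1ℚ :- a :+ K) refl (fromℕ k) a ⟩
      1ℚ - a + fromℕ k      ≡⟨ eq ⟩
      0ℚ                    ∎)))
      where
      open ≡-Reasoning
      open +-*-Solver

    1+k+a≢0 : ∀ k → fromℕ (suc k) + a ≢ 0ℚ
    1+k+a≢0 k eq = a≢integer (ℤ.- + suc k) (trans (inverseʳ-unique (fromℕ (suc k)) a eq) (sym (fromℤ-neg (+ suc k))))

    1+k-a≢0 : ∀ k → fromℕ (suc k) + - a ≢ 0ℚ
    1+k-a≢0 k eq = a≢integer (+ suc k) (sym (x∙y⁻¹≈ε⇒x≈y (fromℕ (suc k)) a eq))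

    -- hterm multiplies by inv ((1 - a + k) (k + 1)), a true inverse since a = m/n is not an integer.
    hterm-ratio : HypergeometricRatio a r h
    hterm-ratio k _ = begin
      h k * ((- R + K) * ((- R + - a) + K)) * inv (G * S) * (S * (1ℚ - a + K))
        ≡⟨ solve 6 (λ h R K a i S → h :* ((:- R :+ K) :* ((:- R :+ :- a) :+ K)) :* i :* (S :* (con 1ℚ :- a :+ K))
                                  := h :* ((:- R :+ K) :* ((:- R :+ :- a) :+ K)) :* (((con 1ℚ :+ :- a :+ K) :* S) :* i))
                 refl (h k) R K a (inv (G * S)) S ⟩
      h k * ((- R + K) * ((- R + - a) + K)) * (G * S * inv (G * S))
        ≡⟨ cong (h k * ((- R + K) * ((- R + - a) + K)) *_) (*-inv (G * S) (*-≢0 (1-a+k≢0 k) (fromℕ-suc≢0 k))) ⟩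
      h k * ((- R + K) * ((- R + - a) + K)) * 1ℚ
        ≡⟨ solve 4 (λ h R K a → h :* ((:- R :+ K) :* ((:- R :+ :- a) :+ K)) :* con 1ℚ := h :* ((R :- K) :* (R :- K :+ a))) refl (h k) R K a ⟩
      h k * ((R - K) * (R - K + a)) ∎
      where
      open ≡-Reasoning
      open +-*-Solver
      K = fromℕ k
      S = fromℕ (suc k)
      G = 1ℚ + - a + K

    module Y = HypergeometricPolynomial a r h hterm-ratio
    module X = HypergeometricPolynomial (- a) r (λ k → h (r ℕ.∸ k)) (HypergeometricRatio-reverse {a} {r} {h} hterm-ratio)

    Ypoly≡ : Ypoly m n r ≡ Y.P
    Ypoly≡ = LP.map-applyUpTo (λ k → k) h (suc r)

    Xpoly≡ : Xpoly m n r ≡ X.P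
    Xpoly≡ = trans (cong reverse Ypoly≡) (trans (LP.reverse-applyUpTo h (suc r)) (applyDownFrom≡applyUpTo h (suc r)))

  module _ {d : ℕ} (d∣n : d ∣ₙ n) where

    private
      D = fromℕ d
      e = ℕ∣._∣_.quotient d∣n

      D*e≡N : D * fromℕ e ≡ N
      D*e≡N = trans (ℚP.*-comm D (fromℕ e)) (sym (trans (cong fromℕ (ℕ∣._∣_.equality d∣n)) (fromℕ-* e d)))

      d⊥m : Coprime d m
      d⊥m {c} (c∣d , c∣m) = ℕ∣.∣1⇒≡1 (subst (c ∣ₙ_) gcd≡1 (gcd-greatest c∣m (ℕ∣.∣-trans c∣d d∣n)))

      N[1-a] : CoprimeIntegral d (N * (1ℚ - a))
      N[1-a] = subst (CoprimeIntegral d) eq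
        (CoprimeIntegral-+-multiple (ℤ.- + m , refl , subst (Coprime d) (sym (ℤP.∣-i∣≡∣i∣ (+ m))) d⊥m) (Integral-fromℕ e))
        where
        open ≡-Reasoning
        open +-*-Solver
        eq : fromℤ (ℤ.- + m) + D * fromℕ e ≡ N * (1ℚ - a)
        eq = begin
          fromℤ (ℤ.- + m) + D * fromℕ e   ≡⟨ cong₂ _+_ (fromℤ-neg (+ m)) D*e≡N ⟩
          - fromℕ m + N                   ≡⟨ cong (λ t → - t + N) (sym N*a≡m) ⟩
          - (N * a) + N                   ≡⟨ solve 2 (λ N a → :- (N :* a) :+ N := N :* (con 1ℚ :- a)) refl N a ⟩
          N * (1ℚ - a)                    ∎

      N[1+a] : CoprimeIntegral d (N * (1ℚ - - a))
      N[1+a] = subst (CoprimeIntegral d) eq (CoprimeIntegral-+-multiple (+ m , refl , d⊥m) (Integral-fromℕ e))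
        where
        open ≡-Reasoning
        open +-*-Solver
        eq : fromℕ m + D * fromℕ e ≡ N * (1ℚ - - a)
        eq = begin
          fromℕ m + D * fromℕ e   ≡⟨ cong₂ _+_ (sym N*a≡m) D*e≡N ⟩
          N * a + N               ≡⟨ solve 2 (λ N a → N :* a :+ N := N :* (con 1ℚ :- :- a)) refl N a ⟩
          N * (1ℚ - - a)          ∎

      N[R+a] : Integral (N * (R + a))
      N[R+a] = subst Integral eq (Integral-+ (Integral-fromℕ (n ℕ.* r)) (Integral-fromℕ m))
        where
        eq : fromℕ (n ℕ.* r) + fromℕ m ≡ N * (R + a)
        eq = trans (cong₂ _+_ (fromℕ-* n r) (sym N*a≡m)) (sym (ℚP.*-distribˡ-+ N R a))

      N[R-a] : Integral (N * (R + - a))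
      N[R-a] = subst Integral eq (Integral-+ (Integral-fromℕ (n ℕ.* r)) (Integral-neg (Integral-fromℕ m)))
        where
        eq : fromℕ (n ℕ.* r) + - fromℕ m ≡ N * (R + - a)
        eq = trans (cong₂ (λ x y → x + - y) (fromℕ-* n r) (sym N*a≡m))
                   (solve 3 (λ N R a → N :* R :+ :- (N :* a) := N :* (R :+ :- a)) refl N R a)
          where open +-*-Solver

      divides-0ℚ : (+ (d ^ r)) ∣ ↥ 0ℚ
      divides-0ℚ = (d ^ r) ℕ∣.∣0

      Y-coeff-divisible : ∀ j → (+ (d ^ r)) ∣ ↥ (coeff (Y.P ∘ₚ oneMinus d) j)
      Y-coeff-divisible j = [ closed , vanishing ]′ (ℕP.≤-<-connex j r)
        where
        open ≡-Reasoning
        open +-*-Solver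
        i = r ℕ.∸ j
        γ = coeff (Y.P ∘ₚ oneMinus d) j
        ρ = (1ℚ - a) ↑ r
        f = (R + a) ↓ j
        vanishing : r ℕ.< j → (+ (d ^ r)) ∣ ↥ γ
        vanishing r<j = subst (λ q → (+ (d ^ r)) ∣ ↥ q) (sym (Y.coeff-above d r<j)) divides-0ℚ
        closed : j ≤ r → (+ (d ^ r)) ∣ ↥ γ
        closed j≤r = numerator-divisible-^ {q = γ} d∣n j≤r (CoprimeIntegral-↑ {n = n} d∣n N[1-a] r)
                       (Integral-* (Integral-fromℕ M) (Integral-↓ {n} N[R+a] j)) (begin
          γ * (N ^ℚ r * ρ)                                  ≡⟨ solve 3 (λ γ P ρ → γ :* (P :* ρ) := γ :* ρ :* P) refl γ (N ^ℚ r) ρ ⟩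
          γ * ρ * N ^ℚ r                                    ≡⟨ cong₂ _*_ (proj₂ (Y.coeff-closed 1+k+a≢0 d j j≤r)) (^ℚ-split N j≤r) ⟩
          (- D) ^ℚ j * fromℕ M * 1ℚ * f * (N ^ℚ j * N ^ℚ i)  ≡⟨ solve 5 (λ Dj M f Nj Ni → Dj :* M :* con 1ℚ :* f :* (Nj :* Ni) := Dj :* Ni :* (M :* (Nj :* f))) refl ((- D) ^ℚ j) (fromℕ M) f (N ^ℚ j) (N ^ℚ i) ⟩
          (- D) ^ℚ j * N ^ℚ i * (fromℕ M * (N ^ℚ j * f))     ∎)
          where
          M = proj₁ (Y.coeff-closed 1+k+a≢0 d j j≤r)

      -- The X-coefficients have c 0 = h r, which c-top turns into the rising factorial (1 + a)⁽ʳ⁾.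
      h-top : h r * (1ℚ - a) ↑ r ≡ (1ℚ - - a) ↑ r
      h-top = begin
        h r * (1ℚ - a) ↑ r  ≡⟨ Y.c-top ⟩
        1ℚ * (R + a) ↓ r    ≡⟨ ℚP.*-identityˡ _ ⟩
        (R + a) ↓ r         ≡⟨ cong (_↓ r) (ℚP.+-comm R a) ⟩
        (a + R) ↓ r         ≡⟨ ↓≡↑ a r ⟩
        (a + 1ℚ) ↑ r        ≡⟨ cong (_↑ r) (solve 1 (λ a → a :+ con 1ℚ := con 1ℚ :- :- a) refl a) ⟩
        (1ℚ - - a) ↑ r      ∎
        where
        open ≡-Reasoning
        open +-*-Solver

      X-coeff-divisible : ∀ j → (+ (d ^ r)) ∣ ↥ (coeff (X.P ∘ₚ oneMinus d) j)
      X-coeff-divisible j = [ closed , vanishing ]′ (ℕP.≤-<-connex j r)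
        where
        open ≡-Reasoning
        open +-*-Solver
        i = r ℕ.∸ j
        γ = coeff (X.P ∘ₚ oneMinus d) j
        ρ₊ = (1ℚ - - a) ↑ r
        ρ₋ = (1ℚ - a) ↑ r
        f = (R + - a) ↓ j
        N^rρ₊ : CoprimeIntegral d (N ^ℚ r * ρ₊)
        N^rρ₊ = CoprimeIntegral-↑ {n = n} d∣n N[1+a] r
        vanishing : r ℕ.< j → (+ (d ^ r)) ∣ ↥ γ
        vanishing r<j = subst (λ q → (+ (d ^ r)) ∣ ↥ q) (sym (X.coeff-above d r<j)) divides-0ℚ
        closed : j ≤ r → (+ (d ^ r)) ∣ ↥ γ
        closed j≤r = numerator-divisible-^ {q = γ} d∣n j≤r (CoprimeIntegral-* N^rρ₊ (CoprimeIntegral-↑ {n = n} d∣n N[1-a] r))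
                       (Integral-* (Integral-* (Integral-fromℕ M) (Integral-↓ {n} N[R-a] j)) (CoprimeIntegral⇒Integral N^rρ₊)) (begin
          γ * (N ^ℚ r * ρ₊ * (N ^ℚ r * ρ₋))                        ≡⟨ solve 4 (λ γ P ρ₊ ρ₋ → γ :* (P :* ρ₊ :* (P :* ρ₋)) := γ :* ρ₊ :* ρ₋ :* P :* P) refl γ (N ^ℚ r) ρ₊ ρ₋ ⟩
          γ * ρ₊ * ρ₋ * N ^ℚ r * N ^ℚ r                             ≡⟨ cong (λ t → t * ρ₋ * N ^ℚ r * N ^ℚ r) (proj₂ (X.coeff-closed 1+k-a≢0 d j j≤r)) ⟩
          (- D) ^ℚ j * fromℕ M * h r * f * ρ₋ * N ^ℚ r * N ^ℚ r      ≡⟨ solve 7 (λ Dj M hr f ρ₋ P Q → Dj :* M :* hr :* f :* ρ₋ :* P :* Q := Dj :* M :* f :* (hr :* ρ₋) :* P :* Q) refl ((- D) ^ℚ j) (fromℕ M) (h r) f ρ₋ (N ^ℚ r) (N ^ℚ r) ⟩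
          (- D) ^ℚ j * fromℕ M * f * (h r * ρ₋) * N ^ℚ r * N ^ℚ r    ≡⟨ cong₂ (λ x y → (- D) ^ℚ j * fromℕ M * f * x * y * N ^ℚ r) h-top (^ℚ-split N j≤r) ⟩
          (- D) ^ℚ j * fromℕ M * f * ρ₊ * (N ^ℚ j * N ^ℚ i) * N ^ℚ r ≡⟨ solve 7 (λ Dj M f ρ₊ Nj Ni P → Dj :* M :* f :* ρ₊ :* (Nj :* Ni) :* P := Dj :* Ni :* (M :* (Nj :* f) :* (P :* ρ₊))) refl ((- D) ^ℚ j) (fromℕ M) f ρ₊ (N ^ℚ j) (N ^ℚ i) (N ^ℚ r) ⟩
          (- D) ^ℚ j * N ^ℚ i * (fromℕ M * (N ^ℚ j * f) * (N ^ℚ r * ρ₊)) ∎)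
          where
          M = proj₁ (X.coeff-closed 1+k-a≢0 d j j≤r)

    Ypoly-coeffs-divisible : All (λ c → (+ (d ^ r)) ∣ (↥ c)) (Ypoly m n r ∘ₚ oneMinus d)
    Ypoly-coeffs-divisible =
      subst (λ p → All (λ c → (+ (d ^ r)) ∣ (↥ c)) (p ∘ₚ oneMinus d)) (sym Ypoly≡) (All-coeff _ Y-coeff-divisible)

    Xpoly-coeffs-divisible : All (λ c → (+ (d ^ r)) ∣ (↥ c)) (Xpoly m n r ∘ₚ oneMinus d)
    Xpoly-coeffs-divisible =
      subst (λ p → All (λ c → (+ (d ^ r)) ∣ (↥ c)) (p ∘ₚ oneMinus d)) (sym Xpoly≡) (All-coeff _ X-coeff-divisible)

lemma3p5 : (m n r d : ℕ) → 1 ≤ m → 1 ≤ n → 1 ≤ r → gcd m n ≡ 1 →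
    1 ≤ d → d ∣ₙ n →
    All (λ c → (+ (d ^ r)) ∣ (↥ c)) (Xpoly m n r ∘ₚ oneMinus d)
      × All (λ c → (+ (d ^ r)) ∣ (↥ c)) (Ypoly m n r ∘ₚ oneMinus d)
lemma3p5 m n r (suc zero) _ _ _ _ _ _ = universal 1^r∣ _ , universal 1^r∣ _
  where
  1^r∣ : ∀ q → (+ (1 ^ r)) ∣ ↥ q
  1^r∣ q = subst (λ k → (+ k) ∣ ↥ q) (sym (ℕP.^-zeroˡ r)) (ℕ∣.1∣ ∣ ↥ q ∣)
lemma3p5 m n r d@(suc (suc _)) _ 1≤n _ gcd≡1 _ d∣n =
  Xpoly-coeffs-divisible {m} {n} {r} 2≤n gcd≡1 d∣n , Ypoly-coeffs-divisible {m} {n} {r} 2≤n gcd≡1 d∣n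
  where
  2≤n : 2 ≤ n
  2≤n = ℕP.≤-trans (s≤s (s≤s z≤n)) (ℕ∣.∣⇒≤ {{ℕ.>-nonZero 1≤n}} d∣n)
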